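{- Let $m,n$ be positive integers with $\gcd(m,n)=1$ and put $l=\gcd(m-1,n)$. Let $D,E,F\in\mathbb{Z}$ and suppose that $$P(x,y)=\frac{n}{2}\Big(x-\frac{m-1}{n}y\Big)^2+\Big(D-\frac n2\Big)x+\Big(E-\frac{(m-1)^2}{2n}\Big)y+F$$ is a quadratic packing polynomial on $I(n/m)$. Define $$k:=\Big(D-\frac n2\Big)\frac{m-1}{l}+\Big(E-\frac{(m-1)^2}{2n}\Big)\frac{n}{l},$$ and $\hat P(x,y):=P\big(x+\tfrac{m-1}{n}y,\,y\big)$. Suppose $k>0$. Then for every $i\in\mathbb{N}_0$, every element of $\hat P(\hat J_i)$ is congruent modulo $k$ to every element of $\hat P(\hat J_{i+k})$.
   Context: For $\alpha>0$, $I(\alpha)=\{(x,y)\in\mathbb{Z}^2: 0\le y\le \alpha x\}$. A quadratic packing polynomial (QPP) on a countable set $I\subset\mathbb{R}^2$ is a real polynomial of degree $2$ whose restriction to $I$ is a bijection from $I$ onto $\mathbb{N}_0=\{0,1,2,\dots\}$. Let $\hat I=\{(x-\frac{m-1}{n}y,\,y):(x,y)\in I(n/m)\}$, and for $i\in\mathbb{N}_0$ let $\hat J_i=\{(x,y)\in\hat I: x=il/n\}$ (the $i$th staircase). -}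

module Defs where

open import Data.Nat.Base as ℕ using (ℕ; NonZero; _∸_; ≢-nonZero; ≢-nonZero⁻¹)
open import Data.Nat.GCD using (gcd; gcd[m,n]≢0)
open import Data.Integer.Base as ℤ using (ℤ; +_)
open import Data.Rational.Base using (ℚ; _/_; _+_; _*_; _-_; _≤_; ½; 0ℚ)
open import Data.Product using (_×_; ∃-syntax)
open import Data.Sum using (inj₂)
open import Relation.Binary.PropositionalEquality using (_≡_)

⟦_⟧ : ℤ → ℚ
⟦ z ⟧ = z / 1

lN : ℕ → ℕ → ℕ
lN m n = gcd (m ∸ 1) n

lN-nonZero : ∀ m n → ⦃ NonZero n ⦄ → NonZero (lN m n)
lN-nonZero m n ⦃ nz ⦄ = ≢-nonZero (gcd[m,n]≢0 (m ∸ 1) n (inj₂ (≢-nonZero⁻¹ n)))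

c : (m n : ℕ) → ⦃ NonZero n ⦄ → ℚ
c m n = + (m ∸ 1) / n

module _ (m n : ℕ) ⦃ nz : NonZero n ⦄ (D E F : ℤ) where

  coefX : ℚ
  coefX = ⟦ D ⟧ - (+ n / 1) * ½

  coefY : ℚ
  coefY = ⟦ E ⟧ - (+ ((m ∸ 1) ℕ.* (m ∸ 1)) / n) * ½

  P : ℚ → ℚ → ℚ
  P x y = ((+ n / 1) * ½) * ((x - c m n * y) * (x - c m n * y)) + coefX * x + coefY * y + ⟦ F ⟧

  Phat : ℚ → ℚ → ℚ
  Phat x y = P (x + c m n * y) y

  k : ℚ
  k = coefX * _/_ (+ (m ∸ 1)) (lN m n) ⦃ lN-nonZero m n ⦄
    + coefY * _/_ (+ n) (lN m n) ⦃ lN-nonZero m n ⦄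

InI : (m n : ℕ) → ⦃ NonZero m ⦄ → ℤ → ℤ → Set
InI m n x y = (0ℚ ≤ ⟦ y ⟧) × (⟦ y ⟧ ≤ (+ n / m) * ⟦ x ⟧)

IsQPPonI : (m n : ℕ) → ⦃ NonZero m ⦄ → (ℚ → ℚ → ℚ) → Set
IsQPPonI m n Q =
  (∀ x y → InI m n x y → ∃[ N ] Q ⟦ x ⟧ ⟦ y ⟧ ≡ ⟦ + N ⟧)
  × (∀ x y x′ y′ → InI m n x y → InI m n x′ y′ → Q ⟦ x ⟧ ⟦ y ⟧ ≡ Q ⟦ x′ ⟧ ⟦ y′ ⟧ → (x ≡ x′) × (y ≡ y′))
  × (∀ (N : ℕ) → ∃[ x ] ∃[ y ] InI m n x y × (Q ⟦ x ⟧ ⟦ y ⟧ ≡ ⟦ + N ⟧))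

InIhat : (m n : ℕ) → ⦃ NonZero m ⦄ → ⦃ NonZero n ⦄ → ℚ → ℚ → Set
InIhat m n a b = ∃[ x ] ∃[ y ] InI m n x y × (a ≡ ⟦ x ⟧ - c m n * ⟦ y ⟧) × (b ≡ ⟦ y ⟧)

InJhat : (m n : ℕ) → ⦃ NonZero m ⦄ → ⦃ NonZero n ⦄ → ℚ → ℚ → ℚ → Set
InJhat m n j a b = InIhat m n a b × (a ≡ j * (+ lN m n / n))

CongMod : ℚ → ℚ → ℚ → Set
CongMod q a b = ∃[ t ] a - b ≡ ⟦ t ⟧ * q

{-# OPTIONS --safe #-}
module Submission where

-- Multiplying by 2n turns P into the integer form H = A² + βA + 2κy + C, where
-- A = n x − (m−1) y = l·s with s the index of the staircase through (x, y), κ = l k,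
-- β = 2D − n and C = 2nF.  A step (x, y) ↦ (x + (m−1)/l, y + n/l) along a staircase fixes s
-- and raises H by ρ = 2nk, so H is constant modulo ρ on each staircase.  Take a point e of
-- staircase i on the edge 0 ≤ n x − m y < n/l and, by surjectivity, the point q with
-- H(q) = H(e) + ρ.  The point q lies on the bottom step y < n/l, for otherwise the step below
-- q would be a second point of value H(e).  With a = A(e) and a′ = A(q) the equation
-- H(q) = H(e) + ρ reads (a′ − a − κ)(a + a′ + κ + β) = R with |R| bounded independently of a,
-- so a′ = a + κ once a is large: q lies on staircase i + k, and H agrees modulo ρ on the
-- staircases i and i + k.  Translating x makes a large and changes the difference of two
-- values on the staircases i and i + k by a multiple of ρ.

open import Defs

module IntegerModel where
  open import Data.Nat.Base as ℕ using (ℕ; z≤n; s≤s)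
  import Data.Nat.Properties as ℕ
  import Data.Nat.Divisibility as ℕ
  open import Data.Nat.DivMod as ℕ using (_/_; _%_; m≡m%n+[m/n]*n; m%n<n)
  open import Data.Nat.Coprimality using (Coprime; coprime-divisor)
  open import Data.Integer.Base hiding (_/_; _%_)
  open import Data.Integer.Properties
  open import Data.Integer.Divisibility.Signed
    using (_∣_; divides; ∣-refl; ∣ᵤ⇒∣; ∣⇒∣ᵤ; ∣m∣n⇒∣m+n; ∣m+n∣n⇒∣m; ∣n⇒∣m*n)
  open import Data.Integer.Tactic.RingSolver using (solve-∀)
  open import Algebra.Properties.CommutativeSemigroup *-commutativeSemigroup
    using () renaming (x∙yz≈y∙xz to x*[y*z]≡y*[x*z])
  open import Algebra.Properties.CommutativeSemigroup +-commutativeSemigroup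
    using () renaming (xy∙z≈xz∙y to [x+y]+z≡[x+z]+y)
  open import Data.Empty using (⊥-elim)
  open import Data.Product using (∃-syntax; _×_; _,_; proj₁; proj₂)
  open import Relation.Nullary using (yes; no)
  open import Relation.Binary.PropositionalEquality

  2ℤ : ℤ
  2ℤ = + 2

  i≡j+[i-j] : ∀ i j → i ≡ j + (i - j)
  i≡j+[i-j] = solve-∀

  infixl 6 _⊕_
  infixl 7 _⊛_

  _⊕_ : ∀ {i j} → 0ℤ ≤ i → 0ℤ ≤ j → 0ℤ ≤ i + j
  _⊕_ = +-mono-≤

  _⊛_ : ∀ {i j} → 0ℤ ≤ i → 0ℤ ≤ j → 0ℤ ≤ i * j
  _⊛_ {+ m} {+ n} _ _ = subst (0ℤ ≤_) (pos-* m n) (+≤+ z≤n)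

  0≤+ : ∀ n → 0ℤ ≤ + n
  0≤+ _ = +≤+ z≤n

  j≤i+j : ∀ {i j} → 0ℤ ≤ i → j ≤ i + j
  j≤i+j {i} {j} 0≤i = subst (_≤ i + j) (+-identityˡ j) (+-monoˡ-≤ j 0≤i)

  <-by-gap : ∀ {r w x} → 0ℤ ≤ x → w ≡ x + (1ℤ + r) → r < w
  <-by-gap {r} 0≤x w≡ = suc[i]≤j⇒i<j (subst (suc r ≤_) (sym w≡) (j≤i+j 0≤x))

  -1<i<1⇒i≡0 : ∀ {i} → -1ℤ < i → i < 1ℤ → i ≡ 0ℤ
  -1<i<1⇒i≡0 {+0}       _        _              = refl
  -1<i<1⇒i≡0 {+[1+ n ]} _        (+<+ (s≤s ()))
  -1<i<1⇒i≡0 { -[1+ n ]} (-<- ()) _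

  -w<d*w<w⇒d≡0 : ∀ d w → - w < d * w → d * w < w → d ≡ 0ℤ
  -w<d*w<w⇒d≡0 d (+ n) lo hi = -1<i<1⇒i≡0
    (*-cancelʳ-<-nonNeg (+ n) (subst (_< d * + n) (sym (-1*i≡-i (+ n))) lo))
    (*-cancelʳ-<-nonNeg (+ n) (subst (d * + n <_) (sym (*-identityˡ (+ n))) hi))
  -w<d*w<w⇒d≡0 d -[1+ n ] lo hi with <-trans lo hi
  ... | ()

  0≤∣i∣+i : ∀ i → 0ℤ ≤ + ∣ i ∣ + i
  0≤∣i∣+i (+ n)     = 0≤+ (n ℕ.+ n)
  0≤∣i∣+i -[1+ n ] = ≤-reflexive (sym (+-inverseʳ (+ ℕ.suc n)))

  0≤∣i∣-i : ∀ i → 0ℤ ≤ + ∣ i ∣ - i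
  0≤∣i∣-i (+ n)     = i≤j⇒0≤j-i (≤-refl {+ n})
  0≤∣i∣-i -[1+ n ] = 0≤+ (ℕ.suc n ℕ.+ ℕ.suc n)

  private
    quadratic-factorisation : ∀ κ β a a′ y y′ →
      (a′ - (a + κ)) * (a + a′ + κ + β) ≡
      ((a′ * a′ + β * a′ + 2ℤ * κ * y′) - (a * a + β * a + 2ℤ * κ * y))
        - (2ℤ * κ * y′ + 2ℤ * κ * (a - y) + κ * κ + κ * β)
    quadratic-factorisation = solve-∀

    upper-gap : ∀ n₁ κ β b a a′ r y′ →
      a + a′ + κ + β ≡
      ((a - (2ℤ * (1ℤ + κ) * b + 2ℤ * n₁ * κ + κ * κ + 1ℤ)) + a′ + κ + (b + β) + b
         + κ * (b + β) + κ * b + 2ℤ * κ * κ + 2ℤ * κ * y′ + 2ℤ * κ * r)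
      + (1ℤ + (2ℤ * n₁ * κ - (2ℤ * κ * y′ + 2ℤ * κ * r + κ * κ + κ * β)))
    upper-gap = solve-∀

    lower-gap : ∀ n₁ κ β b a a′ r y′ →
      2ℤ * n₁ * κ - (2ℤ * κ * y′ + 2ℤ * κ * r + κ * κ + κ * β) ≡
      ((a - (2ℤ * (1ℤ + κ) * b + 2ℤ * n₁ * κ + κ * κ + 1ℤ)) + a′ + κ + (b + β) + b
         + κ * (b - β) + κ * b + 2ℤ * κ * (n₁ - y′) + 2ℤ * κ * (n₁ - r))
      + (1ℤ + - (a + a′ + κ + β))
    lower-gap = solve-∀

    [i+j]-i≡j : ∀ v c → (v + c) - v ≡ c
    [i+j]-i≡j = solve-∀

  module QuadraticStep (n₁ κ β : ℤ) (0≤κ : 0ℤ ≤ κ) where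

    f : ℤ → ℤ → ℤ
    f a y = a * a + β * a + 2ℤ * κ * y

    -- Beyond threshold, the slacks in upper-gap and lower-gap are sums of nonnegative terms.
    threshold : ℤ
    threshold = 2ℤ * (1ℤ + κ) * + ∣ β ∣ + 2ℤ * n₁ * κ + κ * κ + 1ℤ

    successor-index-forced : ∀ {a a′ y y′} → threshold ≤ a → 0ℤ ≤ a′ →
                  0ℤ ≤ y′ → y′ ≤ n₁ → 0ℤ ≤ a - y → a - y ≤ n₁ →
                  f a′ y′ ≡ f a y + 2ℤ * n₁ * κ → a′ ≡ a + κ
    successor-index-forced {a} {a′} {y} {y′} deep 0≤a′ 0≤y′ y′≤n₁ 0≤r r≤n₁ step = begin
        a′                        ≡⟨ i≡j+[i-j] a′ (a + κ) ⟩
        (a + κ) + (a′ - (a + κ))  ≡⟨ cong (_+_ (a + κ)) d≡0 ⟩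
        (a + κ) + 0ℤ              ≡⟨ +-identityʳ (a + κ) ⟩
        a + κ                     ∎
      where
      open ≡-Reasoning
      r = a - y
      W R : ℤ
      W = a + a′ + κ + β
      R = 2ℤ * n₁ * κ - (2ℤ * κ * y′ + 2ℤ * κ * r + κ * κ + κ * β)
      dW≡R : (a′ - (a + κ)) * W ≡ R
      dW≡R = begin
        (a′ - (a + κ)) * W
          ≡⟨ quadratic-factorisation κ β a a′ y y′ ⟩
        (f a′ y′ - f a y) - (2ℤ * κ * y′ + 2ℤ * κ * r + κ * κ + κ * β)
          ≡⟨ cong (λ v → (v - f a y) - (2ℤ * κ * y′ + 2ℤ * κ * r + κ * κ + κ * β)) step ⟩
        ((f a y + 2ℤ * n₁ * κ) - f a y) - (2ℤ * κ * y′ + 2ℤ * κ * r + κ * κ + κ * β)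
          ≡⟨ cong (_- (2ℤ * κ * y′ + 2ℤ * κ * r + κ * κ + κ * β)) ([i+j]-i≡j (f a y) (2ℤ * n₁ * κ)) ⟩
        R ∎
      0≤a-T = i≤j⇒0≤j-i deep
      0≤2κ = 0≤+ 2 ⊛ 0≤κ
      R<W : R < W
      R<W = <-by-gap (0≤a-T ⊕ 0≤a′ ⊕ 0≤κ ⊕ 0≤∣i∣+i β ⊕ 0≤+ ∣ β ∣
                      ⊕ 0≤κ ⊛ 0≤∣i∣+i β ⊕ 0≤κ ⊛ 0≤+ ∣ β ∣ ⊕ 0≤2κ ⊛ 0≤κ ⊕ 0≤2κ ⊛ 0≤y′
                      ⊕ 0≤2κ ⊛ 0≤r)
                     (upper-gap n₁ κ β (+ ∣ β ∣) a a′ r y′)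
      -W<R : - W < R
      -W<R = <-by-gap (0≤a-T ⊕ 0≤a′ ⊕ 0≤κ ⊕ 0≤∣i∣+i β ⊕ 0≤+ ∣ β ∣
                       ⊕ 0≤κ ⊛ 0≤∣i∣-i β ⊕ 0≤κ ⊛ 0≤+ ∣ β ∣ ⊕ 0≤2κ ⊛ i≤j⇒0≤j-i y′≤n₁
                       ⊕ 0≤2κ ⊛ i≤j⇒0≤j-i r≤n₁)
                      (lower-gap n₁ κ β (+ ∣ β ∣) a a′ r y′)
      d≡0 : a′ - (a + κ) ≡ 0ℤ
      d≡0 = -w<d*w<w⇒d≡0 (a′ - (a + κ)) W
              (subst (- W <_) (sym dW≡R) -W<R) (subst (_< W) (sym dW≡R) R<W)

  private
    staircase-invariant : ∀ n m x y t → n * (x + m * t) - m * (y + n * t) ≡ n * x - m * y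
    staircase-invariant = solve-∀

    index-shift : ∀ n m x y t → n * (x + t) - m * y ≡ (n * x - m * y) + n * t
    index-shift = solve-∀

    difference-of-indices : ∀ n m X Y x y → n * (X - x) - m * (Y - y) ≡ (n * X - m * Y) - (n * x - m * y)
    difference-of-indices = solve-∀

    f-along-staircase : ∀ κ β n a y t c →
      a * a + β * a + 2ℤ * κ * (y + n * t) + c ≡ (a * a + β * a + 2ℤ * κ * y + c) + t * (2ℤ * n * κ)
    f-along-staircase = solve-∀

    f-along-shift : ∀ κ β a ν y y′ c →
      ((a + κ + ν) * (a + κ + ν) + β * (a + κ + ν) + 2ℤ * κ * y′ + c)
        - ((a + ν) * (a + ν) + β * (a + ν) + 2ℤ * κ * y + c) ≡
      (((a + κ) * (a + κ) + β * (a + κ) + 2ℤ * κ * y′ + c) - (a * a + β * a + 2ℤ * κ * y + c))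
        + ν * (2ℤ * κ)
    f-along-shift = solve-∀

    shift-multiple : ∀ l n t κ → l * n * t * (2ℤ * κ) ≡ (l * t) * (2ℤ * n * κ)
    shift-multiple = solve-∀

    i-[j+k]≡[i-j]-k : ∀ a y d → a - (y + d) ≡ (a - y) - d
    i-[j+k]≡[i-j]-k = solve-∀

    [i+k]-j≡[i-j]+k : ∀ a y d → (a + d) - y ≡ (a - y) + d
    [i+k]-j≡[i-j]+k = solve-∀

    [r+q*n]-n*q≡r : ∀ r q n → (r + q * n) - n * q ≡ r
    [r+q*n]-n*q≡r = solve-∀

    i+j*-1≡i-j : ∀ u n → u + n * -1ℤ ≡ u - n
    i+j*-1≡i-j = solve-∀

    i-j*-1≡i+j : ∀ u n → u - n * -1ℤ ≡ u + n
    i-j*-1≡i+j = solve-∀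

    [i+j]+-1*j≡i : ∀ h c → (h + c) + -1ℤ * c ≡ h
    [i+j]+-1*j≡i = solve-∀

    i≡[i+j]-j : ∀ u c → u ≡ (u + c) - c
    i≡[i+j]-j = solve-∀

    telescope : ∀ a b c d → a - d ≡ ((a - b) + (b - c)) + (c - d)
    telescope = solve-∀

  i≤+∣i∣ : ∀ i → i ≤ + ∣ i ∣
  i≤+∣i∣ (+ n)     = ≤-refl
  i≤+∣i∣ -[1+ n ] = -≤+

  -- With n = l n₁ and m − 1 = l m₁: (x, y) lies on the staircase Ĵ_(s x y), gap x y = n x − m y,
  -- and In is membership in I(n/m).
  module Staircases (l n₁ m₁ : ℕ) ⦃ _ : ℕ.NonZero l ⦄ ⦃ _ : ℕ.NonZero n₁ ⦄
                    (coprime : Coprime n₁ m₁) where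

    L N₁ M₁ : ℤ
    L  = + l
    N₁ = + n₁
    M₁ = + m₁

    s A gap : ℤ → ℤ → ℤ
    s x y   = N₁ * x - M₁ * y
    A x y   = L * s x y
    gap x y = A x y - y

    In : ℤ → ℤ → Set
    In x y = 0ℤ ≤ y × 0ℤ ≤ gap x y

    Edge : ℤ → ℤ → Set
    Edge x y = In x y × gap x y < N₁

    s-step : ∀ x y t → s (x + M₁ * t) (y + N₁ * t) ≡ s x y
    s-step x y t = staircase-invariant N₁ M₁ x y t

    A-step : ∀ x y t → A (x + M₁ * t) (y + N₁ * t) ≡ A x y
    A-step x y t = cong (L *_) (s-step x y t)

    gap-step : ∀ x y t → gap (x + M₁ * t) (y + N₁ * t) ≡ gap x y - N₁ * t
    gap-step x y t = trans (cong (_- (y + N₁ * t)) (A-step x y t)) (i-[j+k]≡[i-j]-k (A x y) y (N₁ * t))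

    s-shift : ∀ x y t → s (x + t) y ≡ s x y + N₁ * t
    s-shift x y t = index-shift N₁ M₁ x y t

    A-shift : ∀ x y t → A (x + t) y ≡ A x y + L * N₁ * t
    A-shift x y t = begin
      L * s (x + t) y          ≡⟨ cong (L *_) (s-shift x y t) ⟩
      L * (s x y + N₁ * t)     ≡⟨ *-distribˡ-+ L (s x y) (N₁ * t) ⟩
      A x y + L * (N₁ * t)     ≡⟨ cong (_+_ (A x y)) (sym (*-assoc L N₁ t)) ⟩
      A x y + L * N₁ * t       ∎
      where open ≡-Reasoning

    0≤A : ∀ {x y} → In x y → 0ℤ ≤ A x y
    0≤A {x} {y} (0≤y , 0≤gap) = subst (0ℤ ≤_) (sym (i≡j+[i-j] (A x y) y)) (0≤y ⊕ 0≤gap)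

    shift-In : ∀ {x y t} → 0ℤ ≤ t → In x y → In (x + t) y
    shift-In {x} {y} {t} 0≤t (0≤y , 0≤gap) =
      0≤y , subst (0ℤ ≤_) (sym gap-shift) (0≤gap ⊕ 0≤+ l ⊛ 0≤+ n₁ ⊛ 0≤t)
      where
      gap-shift : gap (x + t) y ≡ gap x y + L * N₁ * t
      gap-shift = trans (cong (_- y) (A-shift x y t)) ([i+k]-j≡[i-j]+k (A x y) y (L * N₁ * t))

    same-index⇒staircase : ∀ {x y X Y} → s X Y ≡ s x y →
                           ∃[ t ] X ≡ x + M₁ * t × Y ≡ y + N₁ * t
    same-index⇒staircase {x} {y} {X} {Y} eq = t , X≡ , Y≡
      where
      open ≡-Reasoning
      balance : N₁ * (X - x) ≡ M₁ * (Y - y)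
      balance = i-j≡0⇒i≡j _ _ (begin
        N₁ * (X - x) - M₁ * (Y - y) ≡⟨ difference-of-indices N₁ M₁ X Y x y ⟩
        s X Y - s x y               ≡⟨ cong (_- s x y) eq ⟩
        s x y - s x y               ≡⟨ +-inverseʳ (s x y) ⟩
        0ℤ                          ∎)
      N₁∣Y-y : N₁ ∣ Y - y
      N₁∣Y-y = ∣ᵤ⇒∣ (coprime-divisor coprime
        (subst (n₁ ℕ.∣_) (abs-* M₁ (Y - y))
          (∣⇒∣ᵤ (divides (X - x) (trans (sym balance) (*-comm N₁ (X - x)))))))
      t = _∣_.quotient N₁∣Y-y
      Y-y≡ : Y - y ≡ N₁ * t
      Y-y≡ = trans (_∣_.equality N₁∣Y-y) (*-comm t N₁)
      X-x≡ : X - x ≡ M₁ * t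
      X-x≡ = *-cancelˡ-≡ N₁ (X - x) (M₁ * t) (begin
        N₁ * (X - x)   ≡⟨ balance ⟩
        M₁ * (Y - y)   ≡⟨ cong (M₁ *_) Y-y≡ ⟩
        M₁ * (N₁ * t)  ≡⟨ x*[y*z]≡y*[x*z] M₁ N₁ t ⟩
        N₁ * (M₁ * t)  ∎)
      X≡ = trans (i≡j+[i-j] X x) (cong (_+_ x) X-x≡)
      Y≡ = trans (i≡j+[i-j] Y y) (cong (_+_ y) Y-y≡)

    descend-to-edge : ∀ {x y} → In x y → ∃[ t ] Edge (x + M₁ * t) (y + N₁ * t)
    descend-to-edge {x} {y} (0≤y , 0≤gap) =
      + q , (0≤y ⊕ 0≤+ n₁ ⊛ 0≤+ q , subst (0ℤ ≤_) (sym gap≡r) (0≤+ r)) ,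
      subst (_< N₁) (sym gap≡r) (+<+ (m%n<n e n₁))
      where
      e = ∣ gap x y ∣
      q = e / n₁
      r = e % n₁
      gap≡r : gap (x + M₁ * + q) (y + N₁ * + q) ≡ + r
      gap≡r = begin
        gap (x + M₁ * + q) (y + N₁ * + q)  ≡⟨ gap-step x y (+ q) ⟩
        gap x y - N₁ * + q                 ≡⟨ cong (_- N₁ * + q) (sym (0≤i⇒+∣i∣≡i 0≤gap)) ⟩
        + e - N₁ * + q                     ≡⟨ cong (λ v → + v - N₁ * + q) (m≡m%n+[m/n]*n e n₁) ⟩
        + (r ℕ.+ q ℕ.* n₁) - N₁ * + q      ≡⟨ cong (_- N₁ * + q) (trans (pos-+ r (q ℕ.* n₁))
                                                                     (cong (_+_ (+ r)) (pos-* q n₁))) ⟩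
        (+ r + + q * N₁) - N₁ * + q        ≡⟨ [r+q*n]-n*q≡r (+ r) (+ q) N₁ ⟩
        + r                                ∎
        where open ≡-Reasoning

  module Packing (l n₁ m₁ : ℕ) ⦃ _ : ℕ.NonZero l ⦄ ⦃ _ : ℕ.NonZero n₁ ⦄
                 (coprime : Coprime n₁ m₁) (k : ℕ) (β C : ℤ) where

    open Staircases l n₁ m₁ coprime

    κ ρ : ℤ
    κ = L * + k
    ρ = 2ℤ * N₁ * κ

    open QuadraticStep N₁ κ β (0≤+ l ⊛ 0≤+ k)

    H : ℤ → ℤ → ℤ
    H x y = f (A x y) y + C

    H-step : ∀ x y t → H (x + M₁ * t) (y + N₁ * t) ≡ H x y + t * ρ
    H-step x y t = trans (cong (λ a → f a (y + N₁ * t) + C) (A-step x y t))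
                         (f-along-staircase κ β N₁ (A x y) y t C)

    A-index : ∀ {x y x′ y′} → s x′ y′ ≡ s x y + + k → A x′ y′ ≡ A x y + κ
    A-index {x} {y} eq = trans (cong (L *_) eq) (*-distribˡ-+ L (s x y) (+ k))

    same-index⇒∣ : ∀ {x y X Y} → s X Y ≡ s x y → ρ ∣ H X Y - H x y
    same-index⇒∣ {x} {y} {X} {Y} eq = divides t (begin
      H X Y - H x y                        ≡⟨ cong₂ (λ u v → H u v - H x y) X≡ Y≡ ⟩
      H (x + M₁ * t) (y + N₁ * t) - H x y  ≡⟨ cong (_- H x y) (H-step x y t) ⟩
      (H x y + t * ρ) - H x y              ≡⟨ [i+j]-i≡j (H x y) (t * ρ) ⟩
      t * ρ                                ∎)
      where
      open ≡-Reasoning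
      staircase = same-index⇒staircase eq
      t = proj₁ staircase
      X≡ = proj₁ (proj₂ staircase)
      Y≡ = proj₂ (proj₂ staircase)

    shifted-difference : ∀ {x y x′ y′} t → s x′ y′ ≡ s x y + + k →
                         H (x′ + t) y′ - H (x + t) y ≡ (H x′ y′ - H x y) + (L * t) * ρ
    shifted-difference {x} {y} {x′} {y′} t eq = begin
      H (x′ + t) y′ - H (x + t) y
        ≡⟨ cong₂ (λ a′ a → (f a′ y′ + C) - (f a y + C))
                 (trans (A-shift x′ y′ t) (cong (_+ ν) (A-index eq))) (A-shift x y t) ⟩
      (f (A x y + κ + ν) y′ + C) - (f (A x y + ν) y + C)
        ≡⟨ f-along-shift κ β (A x y) ν y y′ C ⟩
      ((f (A x y + κ) y′ + C) - H x y) + ν * (2ℤ * κ)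
        ≡⟨ cong₂ (λ a′ w → (f a′ y′ + C - H x y) + w) (sym (A-index eq)) (shift-multiple L N₁ t κ) ⟩
      (H x′ y′ - H x y) + (L * t) * ρ  ∎
      where
      open ≡-Reasoning
      ν = L * N₁ * t

    module _ (inj : ∀ {x y x′ y′} → In x y → In x′ y′ → H x y ≡ H x′ y′ → x ≡ x′ × y ≡ y′)
             (next : ∀ {x y} → In x y → ∃[ x′ ] ∃[ y′ ] In x′ y′ × H x′ y′ ≡ H x y + ρ) where

      successor-of-edge-is-low : ∀ {X Y X′ Y′} → Edge X Y → In X′ Y′ → H X′ Y′ ≡ H X Y + ρ → Y′ < N₁
      successor-of-edge-is-low {X} {Y} {X′} {Y′} (p , gap<N₁) (0≤Y′ , 0≤gap′) H≡ with Y′ <? N₁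
      ... | yes Y′<N₁ = Y′<N₁
      ... | no Y′≮N₁  = ⊥-elim (<⇒≱ gap<N₁ N₁≤gap)
        where
        X″ = X′ + M₁ * -1ℤ
        Y″ = Y′ + N₁ * -1ℤ
        gap″≡ : gap X″ Y″ ≡ gap X′ Y′ + N₁
        gap″≡ = trans (gap-step X′ Y′ -1ℤ) (i-j*-1≡i+j (gap X′ Y′) N₁)
        p″ : In X″ Y″
        p″ = subst (0ℤ ≤_) (sym (i+j*-1≡i-j Y′ N₁)) (i≤j⇒0≤j-i (≮⇒≥ Y′≮N₁)) ,
             subst (0ℤ ≤_) (sym gap″≡) (0≤gap′ ⊕ 0≤+ n₁)
        H″≡ : H X″ Y″ ≡ H X Y
        H″≡ = trans (H-step X′ Y′ -1ℤ) (trans (cong (_+ -1ℤ * ρ) H≡) ([i+j]+-1*j≡i (H X Y) ρ))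
        N₁≤gap : N₁ ≤ gap X Y
        N₁≤gap = subst (N₁ ≤_) (trans (sym gap″≡) (cong₂ gap (proj₁ (inj p″ p H″≡)) (proj₂ (inj p″ p H″≡))))
                       (j≤i+j 0≤gap′)

      deep-congruence : ∀ {x y x′ y′} → In x y → In x′ y′ → s x′ y′ ≡ s x y + + k →
                        threshold ≤ A x y → ρ ∣ H x′ y′ - H x y
      deep-congruence {x} {y} {x′} {y′} p p′ eq deep with descend-to-edge p
      ... | t , edge with next (proj₁ edge)
      ... | X″ , Y″ , p″ , H″≡ =
        subst (ρ ∣_) (sym (telescope (H x′ y′) (H X″ Y″) (H X Y) (H x y)))
          (∣m∣n⇒∣m+n (∣m∣n⇒∣m+n (same-index⇒∣ (sym s″≡)) ρ∣H″-H) (same-index⇒∣ (s-step x y t)))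
        where
        X = x + M₁ * t
        Y = y + N₁ * t
        f″≡ : f (A X″ Y″) Y″ ≡ f (A X Y) Y + ρ
        f″≡ = trans (i≡[i+j]-j (f (A X″ Y″) Y″) C)
                (trans (cong (_- C) (trans H″≡ ([x+y]+z≡[x+z]+y (f (A X Y) Y) C ρ)))
                  (sym (i≡[i+j]-j (f (A X Y) Y + ρ) C)))
        A″≡ : A X″ Y″ ≡ A X Y + κ
        A″≡ = successor-index-forced (subst (threshold ≤_) (sym (A-step x y t)) deep) (0≤A p″)
                (proj₁ p″) (<⇒≤ (successor-of-edge-is-low edge p″ H″≡))
                (proj₂ (proj₁ edge)) (<⇒≤ (proj₂ edge)) f″≡
        s″≡ : s X″ Y″ ≡ s x′ y′
        s″≡ = *-cancelˡ-≡ L (s X″ Y″) (s x′ y′) (begin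
          L * s X″ Y″          ≡⟨ A″≡ ⟩
          L * s X Y + κ        ≡⟨ cong (λ σ → L * σ + κ) (s-step x y t) ⟩
          L * s x y + κ        ≡⟨ sym (A-index eq) ⟩
          L * s x′ y′          ∎)
          where open ≡-Reasoning
        ρ∣H″-H : ρ ∣ H X″ Y″ - H X Y
        ρ∣H″-H = subst (ρ ∣_) (sym (trans (cong (_- H X Y) H″≡) ([i+j]-i≡j (H X Y) ρ))) ∣-refl

      congruence : ∀ {x y x′ y′} → In x y → In x′ y′ → s x′ y′ ≡ s x y + + k → ρ ∣ H x′ y′ - H x y
      congruence {x} {y} {x′} {y′} p p′ eq =
        ∣m+n∣n⇒∣m (subst (ρ ∣_) (shifted-difference T eq)
                    (deep-congruence (shift-In (0≤+ _) p) (shift-In (0≤+ _) p′) eq-T deep))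
                  (∣n⇒∣m*n (L * T) ∣-refl)
        where
        T = + ∣ threshold ∣
        eq-T : s (x′ + T) y′ ≡ s (x + T) y + + k
        eq-T = begin
          s (x′ + T) y′             ≡⟨ s-shift x′ y′ T ⟩
          s x′ y′ + N₁ * T          ≡⟨ cong (_+ N₁ * T) eq ⟩
          s x y + + k + N₁ * T      ≡⟨ [x+y]+z≡[x+z]+y (s x y) (+ k) (N₁ * T) ⟩
          s x y + N₁ * T + + k      ≡⟨ cong (_+ + k) (sym (s-shift x y T)) ⟩
          s (x + T) y + + k         ∎
          where open ≡-Reasoning
        T≤LN₁T : T ≤ L * N₁ * T
        T≤LN₁T = subst (T ≤_) (trans (pos-* (l ℕ.* n₁) ∣ threshold ∣) (cong (_* T) (pos-* l n₁)))
                   (+≤+ (ℕ.m≤n*m ∣ threshold ∣ (l ℕ.* n₁) ⦃ ℕ.m*n≢0 l n₁ ⦄))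
        deep : threshold ≤ A (x + T) y
        deep = subst (threshold ≤_) (sym (A-shift x y T))
                 (≤-trans (i≤+∣i∣ threshold) (≤-trans T≤LN₁T (j≤i+j (0≤A p))))

module Embedding where
  open import Data.Nat.Base as ℕ using (suc)
  import Data.Nat.Properties as ℕ
  open import Data.Integer.Base as ℤ using (+_)
  import Data.Integer.Properties as ℤ
  open import Data.Rational.Base
  open import Data.Rational.Properties
  import Data.Rational.Unnormalised.Base as ℚᵘ
  import Data.Rational.Unnormalised.Properties as ℚᵘ
  open import Relation.Binary.PropositionalEquality

  private
    toℚᵘ-⟦⟧ : ∀ z → toℚᵘ ⟦ z ⟧ ℚᵘ.≃ ℚᵘ.mkℚᵘ z 0
    toℚᵘ-⟦⟧ z = toℚᵘ-fromℚᵘ (ℚᵘ.mkℚᵘ z 0)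

    toℚᵘ-/ : ∀ z d → toℚᵘ (z / suc d) ℚᵘ.≃ ℚᵘ.mkℚᵘ z d
    toℚᵘ-/ z d = toℚᵘ-fromℚᵘ (ℚᵘ.mkℚᵘ z d)

    ≃-⟦⟧ : ∀ {p z} → toℚᵘ p ℚᵘ.≃ ℚᵘ.mkℚᵘ z 0 → p ≡ ⟦ z ⟧
    ≃-⟦⟧ {z = z} eq = toℚᵘ-injective (ℚᵘ.≃-trans eq (ℚᵘ.≃-sym (toℚᵘ-⟦⟧ z)))

  ⟦⟧-homo-+ : ∀ i j → ⟦ i ℤ.+ j ⟧ ≡ ⟦ i ⟧ + ⟦ j ⟧
  ⟦⟧-homo-+ i j = sym (≃-⟦⟧ {z = i ℤ.+ j} (ℚᵘ.≃-trans (toℚᵘ-homo-+ ⟦ i ⟧ ⟦ j ⟧)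
    (ℚᵘ.≃-trans (ℚᵘ.+-cong (toℚᵘ-⟦⟧ i) (toℚᵘ-⟦⟧ j))
      (ℚᵘ.*≡* (cong (ℤ._* + 1) (cong₂ ℤ._+_ (ℤ.*-identityʳ i) (ℤ.*-identityʳ j)))))))

  ⟦⟧-homo-* : ∀ i j → ⟦ i ℤ.* j ⟧ ≡ ⟦ i ⟧ * ⟦ j ⟧
  ⟦⟧-homo-* i j = sym (≃-⟦⟧ {z = i ℤ.* j} (ℚᵘ.≃-trans (toℚᵘ-homo-* ⟦ i ⟧ ⟦ j ⟧)
    (ℚᵘ.*-cong (toℚᵘ-⟦⟧ i) (toℚᵘ-⟦⟧ j))))

  ⟦⟧-homo-‿- : ∀ i → ⟦ ℤ.- i ⟧ ≡ - ⟦ i ⟧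
  ⟦⟧-homo-‿- i = sym (≃-⟦⟧ {z = ℤ.- i} (ℚᵘ.≃-trans (toℚᵘ-homo‿- ⟦ i ⟧) (ℚᵘ.-‿cong (toℚᵘ-⟦⟧ i))))

  ⟦⟧-homo-− : ∀ i j → ⟦ i ℤ.- j ⟧ ≡ ⟦ i ⟧ - ⟦ j ⟧
  ⟦⟧-homo-− i j = trans (⟦⟧-homo-+ i (ℤ.- j)) (cong (_+_ ⟦ i ⟧) (⟦⟧-homo-‿- j))

  ⟦⟧-injective : ∀ {i j} → ⟦ i ⟧ ≡ ⟦ j ⟧ → i ≡ j
  ⟦⟧-injective {i} {j} eq
    with ℚᵘ.≃-trans (ℚᵘ.≃-sym (toℚᵘ-⟦⟧ i)) (ℚᵘ.≃-trans (toℚᵘ-cong eq) (toℚᵘ-⟦⟧ j))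
  ... | ℚᵘ.*≡* e = trans (sym (ℤ.*-identityʳ i)) (trans e (ℤ.*-identityʳ j))

  ⟦⟧-mono-≤ : ∀ {i j} → i ℤ.≤ j → ⟦ i ⟧ ≤ ⟦ j ⟧
  ⟦⟧-mono-≤ {i} {j} i≤j = toℚᵘ-cancel-≤
    (ℚᵘ.≤-respʳ-≃ (ℚᵘ.≃-sym (toℚᵘ-⟦⟧ j)) (ℚᵘ.≤-respˡ-≃ (ℚᵘ.≃-sym (toℚᵘ-⟦⟧ i))
      (ℚᵘ.*≤* (subst₂ ℤ._≤_ (sym (ℤ.*-identityʳ i)) (sym (ℤ.*-identityʳ j)) i≤j))))

  ⟦⟧-cancel-≤ : ∀ {i j} → ⟦ i ⟧ ≤ ⟦ j ⟧ → i ℤ.≤ j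
  ⟦⟧-cancel-≤ {i} {j} le
    with ℚᵘ.≤-respʳ-≃ (toℚᵘ-⟦⟧ j) (ℚᵘ.≤-respˡ-≃ (toℚᵘ-⟦⟧ i) (toℚᵘ-mono-≤ le))
  ... | ℚᵘ.*≤* h = subst₂ ℤ._≤_ (ℤ.*-identityʳ i) (ℤ.*-identityʳ j) h

  ⟦⟧-cancel-< : ∀ {i j} → ⟦ i ⟧ < ⟦ j ⟧ → i ℤ.< j
  ⟦⟧-cancel-< {i} {j} lt
    with ℚᵘ.<-respʳ-≃ (toℚᵘ-⟦⟧ j) (ℚᵘ.<-respˡ-≃ (toℚᵘ-⟦⟧ i) (toℚᵘ-mono-< lt))
  ... | ℚᵘ.*<* h = subst₂ ℤ._<_ (ℤ.*-identityʳ i) (ℤ.*-identityʳ j) h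

  /-*-⟦⟧ : ∀ z d .⦃ _ : ℕ.NonZero d ⦄ → (z / d) * ⟦ + d ⟧ ≡ ⟦ z ⟧
  /-*-⟦⟧ z (suc d) = ≃-⟦⟧ {z = z} (ℚᵘ.≃-trans (toℚᵘ-homo-* (z / suc d) ⟦ + suc d ⟧)
    (ℚᵘ.≃-trans (ℚᵘ.*-cong (toℚᵘ-/ z d) (toℚᵘ-⟦⟧ (+ suc d))) (ℚᵘ.*≡* eq)))
    where
    eq : (z ℤ.* + suc d) ℤ.* + 1 ≡ z ℤ.* + (suc d ℕ.* 1)
    eq = trans (ℤ.*-identityʳ _) (cong (λ e → z ℤ.* + e) (sym (ℕ.*-identityʳ (suc d))))

  ⟦⟧-*-cancelˡ : ∀ i .⦃ _ : ℤ.NonZero i ⦄ p q → ⟦ i ⟧ * p ≡ ⟦ i ⟧ * q → p ≡ q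
  ⟦⟧-*-cancelˡ i p q eq = begin
    p                          ≡⟨ sym (*-identityˡ p) ⟩
    1ℚ * p                     ≡⟨ cong (_* p) (sym (*-inverseˡ ⟦ i ⟧)) ⟩
    (1/ ⟦ i ⟧) * ⟦ i ⟧ * p     ≡⟨ *-assoc (1/ ⟦ i ⟧) ⟦ i ⟧ p ⟩
    (1/ ⟦ i ⟧) * (⟦ i ⟧ * p)   ≡⟨ cong ((1/ ⟦ i ⟧) *_) eq ⟩
    (1/ ⟦ i ⟧) * (⟦ i ⟧ * q)   ≡⟨ sym (*-assoc (1/ ⟦ i ⟧) ⟦ i ⟧ q) ⟩
    (1/ ⟦ i ⟧) * ⟦ i ⟧ * q     ≡⟨ cong (_* q) (*-inverseˡ ⟦ i ⟧) ⟩
    1ℚ * q                     ≡⟨ *-identityˡ q ⟩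
    q                          ∎
    where
    open ≡-Reasoning
    instance
      ⟦i⟧≢0 : NonZero ⟦ i ⟧
      ⟦i⟧≢0 = ≢-nonZero {⟦ i ⟧} (λ e → ℕ.≢-nonZero⁻¹ ℤ.∣ i ∣ (cong ℤ.∣_∣ (⟦⟧-injective {i} {ℤ.0ℤ} e)))

  module _ (p : ℤ.ℤ) (d : ℕ.ℕ) (z w : ℤ.ℤ) where
    private
      toℚᵘ-rhs : toℚᵘ ((p / suc d) * ⟦ z ⟧) ℚᵘ.≃ ℚᵘ.mkℚᵘ (p ℤ.* z) (d ℕ.* 1)
      toℚᵘ-rhs = ℚᵘ.≃-trans (toℚᵘ-homo-* (p / suc d) ⟦ z ⟧) (ℚᵘ.*-cong (toℚᵘ-/ p d) (toℚᵘ-⟦⟧ z))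
      lhs≡ : w ℤ.* + suc (d ℕ.* 1) ≡ + suc d ℤ.* w
      lhs≡ = trans (cong (λ e → w ℤ.* + suc e) (ℕ.*-identityʳ d)) (ℤ.*-comm w (+ suc d))
      rhs≡ : (p ℤ.* z) ℤ.* + 1 ≡ p ℤ.* z
      rhs≡ = ℤ.*-identityʳ _

    ≤-/-*⇒ : ⟦ w ⟧ ≤ (p / suc d) * ⟦ z ⟧ → + suc d ℤ.* w ℤ.≤ p ℤ.* z
    ≤-/-*⇒ le with ℚᵘ.≤-respʳ-≃ toℚᵘ-rhs (ℚᵘ.≤-respˡ-≃ (toℚᵘ-⟦⟧ w) (toℚᵘ-mono-≤ le))
    ... | ℚᵘ.*≤* h = subst₂ ℤ._≤_ lhs≡ rhs≡ h

    ⇒≤-/-* : + suc d ℤ.* w ℤ.≤ p ℤ.* z → ⟦ w ⟧ ≤ (p / suc d) * ⟦ z ⟧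
    ⇒≤-/-* h = toℚᵘ-cancel-≤ (ℚᵘ.≤-respʳ-≃ (ℚᵘ.≃-sym toℚᵘ-rhs) (ℚᵘ.≤-respˡ-≃ (ℚᵘ.≃-sym (toℚᵘ-⟦⟧ w))
      (ℚᵘ.*≤* (subst₂ ℤ._≤_ (sym lhs≡) (sym rhs≡) h))))

private module ℤ-identities where
  open import Data.Integer.Base using (ℤ; _+_; _-_; _*_; -_; 1ℤ)
  open import Data.Integer.Tactic.RingSolver using (solve-∀)
  open import Relation.Binary.PropositionalEquality using (_≡_)
  open IntegerModel using (2ℤ)

  scaled-index : ∀ l n m x y → l * (n * x - m * y) ≡ (l * n) * x - (l * m) * y
  scaled-index = solve-∀

  gap-form : ∀ n m x y → (n * x - m * y) - y ≡ n * x - (1ℤ + m) * y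
  gap-form = solve-∀

  scaled-period : ∀ l n k → 2ℤ * n * (l * k) ≡ 2ℤ * (l * n) * k
  scaled-period = solve-∀

  negate-difference : ∀ h h′ → h - h′ ≡ - (h′ - h)
  negate-difference = solve-∀

  negate-multiple : ∀ t σ k → - (t * (σ * k)) ≡ σ * (- t * k)
  negate-multiple = solve-∀

  scaled-difference : ∀ l a b → l * a - l * b ≡ l * (a - b)
  scaled-difference = solve-∀


open import Data.Nat.Base using (ℕ; NonZero)
open import Data.Nat.Coprimality using (Coprime)
open import Data.Integer.Base using (ℤ; +_)
open import Data.Rational.Base using (ℚ; _+_; _<_; 0ℚ)
open import Data.Nat.Base as ℕ using (suc)
import Data.Nat.Properties as ℕ
import Data.Nat.DivMod as ℕ
import Data.Nat.Coprimality as Coprimality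
open import Data.Nat.GCD using (gcd[m,n]∣m; gcd[m,n]∣n)
import Data.Integer.Base as ℤ
import Data.Integer.Properties as ℤ
open import Data.Integer.Divisibility.Signed using (_∣_)
open import Data.Rational.Base using (_*_; _-_; _/_; ½; 1ℚ)
open import Data.Rational.Properties using (*-comm)
open import Data.Rational.Solver using (module +-*-Solver)
open import Data.Product using (∃-syntax; _×_; _,_; proj₁; proj₂)
open import Relation.Binary.PropositionalEquality
open Embedding
open ℤ-identities
open IntegerModel using (2ℤ; i≡j+[i-j]; module Staircases; module Packing)

-- The fractions ½, (m−1)/n, (m−1)²/n, (m−1)/l and n/l are opaque to the ring solver; each
-- identity below keeps them in the blocks 2·½, ((m−1)/n)·n, … that are then rewritten
-- (⟦ 2 ⟧ * ½ even reduces to 1ℚ).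
private module ℚ-identities where
  open +-*-Solver

  expand-twice-l-k : ∀ two h N Q D E u v L →
    two * (L * ((D - N * h) * u + (E - Q * h) * v)) ≡
    two * D * (L * u) - (two * h) * N * (L * u) + two * E * (L * v) - (two * h) * (Q * (L * v))
  expand-twice-l-k = solve 9 (λ two h N Q D E u v L →
    two :* (L :* ((D :- N :* h) :* u :+ (E :- Q :* h) :* v)) :=
    two :* D :* (L :* u) :- (two :* h) :* N :* (L :* u) :+ two :* E :* (L :* v) :- (two :* h) :* (Q :* (L :* v))) refl

  drop-ones : ∀ two N M D E →
    two * D * M - 1ℚ * N * M + two * E * N - 1ℚ * (M * M) ≡ two * D * M - N * M + two * E * N - M * M
  drop-ones = solve 5 (λ two N M D E →
    two :* D :* M :- con 1ℚ :* N :* M :+ two :* E :* N :- con 1ℚ :* (M :* M) :=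
    two :* D :* M :- N :* M :+ two :* E :* N :- M :* M) refl

  expand-twice-n-P : ∀ two h N c Q D E F X Y →
    two * N * ((N * h) * ((X - c * Y) * (X - c * Y)) + (D - N * h) * X + (E - Q * h) * Y + F) ≡
    (two * h) * ((N * X - (c * N) * Y) * (N * X - (c * N) * Y)) + two * D * N * X
      - (two * h) * N * N * X + two * N * E * Y - (two * h) * (Q * N) * Y + two * N * F
  expand-twice-n-P = solve 10 (λ two h N c Q D E F X Y →
    two :* N :* ((N :* h) :* ((X :- c :* Y) :* (X :- c :* Y)) :+ (D :- N :* h) :* X :+ (E :- Q :* h) :* Y :+ F) :=
    (two :* h) :* ((N :* X :- (c :* N) :* Y) :* (N :* X :- (c :* N) :* Y)) :+ two :* D :* N :* X
      :- (two :* h) :* N :* N :* X :+ two :* N :* E :* Y :- (two :* h) :* (Q :* N) :* Y :+ two :* N :* F) refl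

  collect-twice-n-P : ∀ two N M D E F X Y →
    1ℚ * ((N * X - M * Y) * (N * X - M * Y)) + two * D * N * X
      - 1ℚ * N * N * X + two * N * E * Y - 1ℚ * (M * M) * Y + two * N * F ≡
    (N * X - M * Y) * (N * X - M * Y) + (two * D - N) * (N * X - M * Y)
      + (two * D * M - N * M + two * E * N - M * M) * Y + two * N * F
  collect-twice-n-P = solve 8 (λ two N M D E F X Y →
    con 1ℚ :* ((N :* X :- M :* Y) :* (N :* X :- M :* Y)) :+ two :* D :* N :* X
      :- con 1ℚ :* N :* N :* X :+ two :* N :* E :* Y :- con 1ℚ :* (M :* M) :* Y :+ two :* N :* F :=
    (N :* X :- M :* Y) :* (N :* X :- M :* Y) :+ (two :* D :- N) :* (N :* X :- M :* Y)
      :+ (two :* D :* M :- N :* M :+ two :* E :* N :- M :* M) :* Y :+ two :* N :* F) refl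

  staircase-gap : ∀ N j K w → N * ((j + K) * w - j * w) ≡ K * (w * N)
  staircase-gap = solve 4 (λ N j K w → N :* ((j :+ K) :* w :- j :* w) := K :* (w :* N)) refl

  scale-difference : ∀ N c X Y X′ Y′ → N * ((X′ - c * Y′) - (X - c * Y)) ≡ (N * X′ - (c * N) * Y′) - (N * X - (c * N) * Y)
  scale-difference = solve 6 (λ N c X Y X′ Y′ →
    N :* ((X′ :- c :* Y′) :- (X :- c :* Y)) := (N :* X′ :- (c :* N) :* Y′) :- (N :* X :- (c :* N) :* Y)) refl

  undo-shear : ∀ X c Y → X - c * Y + c * Y ≡ X
  undo-shear = solve 3 (λ X c Y → X :- c :* Y :+ c :* Y := X) refl

  *-distribˡ-− : ∀ a p q → a * (p - q) ≡ a * p - a * q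
  *-distribˡ-− = solve 3 (λ a p q → a :* (p :- q) := a :* p :- a :* q) refl

open ℚ-identities

module Bridge (m′ n : ℕ) ⦃ n≢0 : NonZero n ⦄ (D E F : ℤ) where

  l : ℕ
  l = lN (suc m′) n

  instance
    l≢0 : NonZero l
    l≢0 = lN-nonZero (suc m′) n

  m₁ n₁ : ℕ
  m₁ = m′ ℕ./ l
  n₁ = n ℕ./ l

  m₁*l≡m′ : m₁ ℕ.* l ≡ m′
  m₁*l≡m′ = ℕ.m/n*n≡m (gcd[m,n]∣m m′ n)

  n₁*l≡n : n₁ ℕ.* l ≡ n
  n₁*l≡n = ℕ.m/n*n≡m (gcd[m,n]∣n m′ n)

  instance
    n₁≢0 : NonZero n₁
    n₁≢0 = ℕ.m*n≢0⇒m≢0 n₁ ⦃ subst NonZero (sym n₁*l≡n) n≢0 ⦄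

  coprime : Coprime n₁ m₁
  coprime = Coprimality.sym (Coprimality.coprime-/gcd m′ n)

  open Staircases l n₁ m₁ coprime public

  +n≡L*N₁ : + n ≡ L ℤ.* N₁
  +n≡L*N₁ = trans (cong +_ (sym n₁*l≡n)) (trans (ℤ.pos-* n₁ l) (ℤ.*-comm N₁ L))

  +m′≡L*M₁ : + m′ ≡ L ℤ.* M₁
  +m′≡L*M₁ = trans (cong +_ (sym m₁*l≡m′)) (trans (ℤ.pos-* m₁ l) (ℤ.*-comm M₁ L))

  A≡ : ∀ x y → A x y ≡ + n ℤ.* x ℤ.- + m′ ℤ.* y
  A≡ x y = trans (scaled-index L N₁ M₁ x y)
                 (sym (cong₂ (λ p q → p ℤ.* x ℤ.- q ℤ.* y) +n≡L*N₁ +m′≡L*M₁))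

  gap≡ : ∀ x y → gap x y ≡ + n ℤ.* x ℤ.- + suc m′ ℤ.* y
  gap≡ x y = trans (cong (ℤ._- y) (A≡ x y)) (gap-form (+ n) (+ m′) x y)

  InI⇒In : ∀ {x y} → InI (suc m′) n x y → In x y
  InI⇒In {x} {y} (0≤y , y≤) =
    ⟦⟧-cancel-≤ 0≤y , subst (ℤ._≤_ ℤ.0ℤ) (sym (gap≡ x y)) (ℤ.i≤j⇒0≤j-i (≤-/-*⇒ (+ n) m′ x y y≤))

  In⇒InI : ∀ {x y} → In x y → InI (suc m′) n x y
  In⇒InI {x} {y} (0≤y , 0≤gap) =
    ⟦⟧-mono-≤ 0≤y , ⇒≤-/-* (+ n) m′ x y (ℤ.0≤i-j⇒j≤i (subst (ℤ._≤_ ℤ.0ℤ) (gap≡ x y) 0≤gap))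

  N M Lq K two : ℚ
  N   = ⟦ + n ⟧
  M   = ⟦ + m′ ⟧
  Lq  = ⟦ + l ⟧
  K   = k (suc m′) n D E F
  two = ⟦ + 2 ⟧

  ⟦A⟧ : ∀ x y → ⟦ A x y ⟧ ≡ N * ⟦ x ⟧ - M * ⟦ y ⟧
  ⟦A⟧ x y = trans (cong ⟦_⟧ (A≡ x y))
    (trans (⟦⟧-homo-− (+ n ℤ.* x) (+ m′ ℤ.* y)) (cong₂ _-_ (⟦⟧-homo-* (+ n) x) (⟦⟧-homo-* (+ m′) y)))

  c*N≡M : c (suc m′) n * N ≡ M
  c*N≡M = /-*-⟦⟧ (+ m′) n

  sq*N≡M*M : (+ (m′ ℕ.* m′) / n) * N ≡ M * M
  sq*N≡M*M = trans (/-*-⟦⟧ (+ (m′ ℕ.* m′)) n) (trans (cong ⟦_⟧ (ℤ.pos-* m′ m′)) (⟦⟧-homo-* (+ m′) (+ m′)))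

  Lq*[m′/l]≡M : Lq * (+ m′ / l) ≡ M
  Lq*[m′/l]≡M = trans (*-comm Lq (+ m′ / l)) (/-*-⟦⟧ (+ m′) l)

  Lq*[n/l]≡N : Lq * (+ n / l) ≡ N
  Lq*[n/l]≡N = trans (*-comm Lq (+ n / l)) (/-*-⟦⟧ (+ n) l)

  twice-l-K : two * (Lq * K) ≡ two * ⟦ D ⟧ * M - N * M + two * ⟦ E ⟧ * N - M * M
  twice-l-K = begin
    two * (Lq * K)
      ≡⟨ expand-twice-l-k two ½ N Q ⟦ D ⟧ ⟦ E ⟧ (+ m′ / l) (+ n / l) Lq ⟩
    two * ⟦ D ⟧ * (Lq * (+ m′ / l)) - 1ℚ * N * (Lq * (+ m′ / l))
      + two * ⟦ E ⟧ * (Lq * (+ n / l)) - 1ℚ * (Q * (Lq * (+ n / l)))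
      ≡⟨ cong₂ (λ u v → two * ⟦ D ⟧ * u - 1ℚ * N * u + two * ⟦ E ⟧ * v - 1ℚ * (Q * v))
               Lq*[m′/l]≡M Lq*[n/l]≡N ⟩
    two * ⟦ D ⟧ * M - 1ℚ * N * M + two * ⟦ E ⟧ * N - 1ℚ * (Q * N)
      ≡⟨ cong (λ q → two * ⟦ D ⟧ * M - 1ℚ * N * M + two * ⟦ E ⟧ * N - 1ℚ * q) sq*N≡M*M ⟩
    two * ⟦ D ⟧ * M - 1ℚ * N * M + two * ⟦ E ⟧ * N - 1ℚ * (M * M)
      ≡⟨ drop-ones two N M ⟦ D ⟧ ⟦ E ⟧ ⟩
    two * ⟦ D ⟧ * M - N * M + two * ⟦ E ⟧ * N - M * M  ∎
    where
    open ≡-Reasoning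
    Q = + (m′ ℕ.* m′) / n

  twice-n-P : ∀ X Y → two * N * P (suc m′) n D E F X Y ≡
              (N * X - M * Y) * (N * X - M * Y) + (two * ⟦ D ⟧ - N) * (N * X - M * Y)
                + two * (Lq * K) * Y + two * N * ⟦ F ⟧
  twice-n-P X Y = begin
    two * N * P (suc m′) n D E F X Y
      ≡⟨ expand-twice-n-P two ½ N (c (suc m′) n) Q ⟦ D ⟧ ⟦ E ⟧ ⟦ F ⟧ X Y ⟩
    1ℚ * ((N * X - (c (suc m′) n * N) * Y) * (N * X - (c (suc m′) n * N) * Y)) + two * ⟦ D ⟧ * N * X
      - 1ℚ * N * N * X + two * N * ⟦ E ⟧ * Y - 1ℚ * (Q * N) * Y + two * N * ⟦ F ⟧
      ≡⟨ cong₂ (λ u v → 1ℚ * ((N * X - u * Y) * (N * X - u * Y)) + two * ⟦ D ⟧ * N * X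
                          - 1ℚ * N * N * X + two * N * ⟦ E ⟧ * Y - 1ℚ * v * Y + two * N * ⟦ F ⟧)
               c*N≡M sq*N≡M*M ⟩
    1ℚ * ((N * X - M * Y) * (N * X - M * Y)) + two * ⟦ D ⟧ * N * X
      - 1ℚ * N * N * X + two * N * ⟦ E ⟧ * Y - 1ℚ * (M * M) * Y + two * N * ⟦ F ⟧
      ≡⟨ collect-twice-n-P two N M ⟦ D ⟧ ⟦ E ⟧ ⟦ F ⟧ X Y ⟩
    (N * X - M * Y) * (N * X - M * Y) + (two * ⟦ D ⟧ - N) * (N * X - M * Y)
      + (two * ⟦ D ⟧ * M - N * M + two * ⟦ E ⟧ * N - M * M) * Y + two * N * ⟦ F ⟧
      ≡⟨ cong (λ w → (N * X - M * Y) * (N * X - M * Y) + (two * ⟦ D ⟧ - N) * (N * X - M * Y)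
                       + w * Y + two * N * ⟦ F ⟧) (sym twice-l-K) ⟩
    (N * X - M * Y) * (N * X - M * Y) + (two * ⟦ D ⟧ - N) * (N * X - M * Y)
      + two * (Lq * K) * Y + two * N * ⟦ F ⟧  ∎
    where
    open ≡-Reasoning
    Q = + (m′ ℕ.* m′) / n

  K≡index-difference : ∀ {j a a′ x y x′ y′} →
    a ≡ ⟦ x ⟧ - c (suc m′) n * ⟦ y ⟧ → a′ ≡ ⟦ x′ ⟧ - c (suc m′) n * ⟦ y′ ⟧ →
    a ≡ j * (+ l / n) → a′ ≡ (j + K) * (+ l / n) → K ≡ ⟦ s x′ y′ ℤ.- s x y ⟧
  K≡index-difference {j} {a} {a′} {x} {y} {x′} {y′} a≡ a′≡ a≡j a′≡j =
    ⟦⟧-*-cancelˡ L K ⟦ s x′ y′ ℤ.- s x y ⟧ (begin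
      Lq * K                                            ≡⟨ *-comm Lq K ⟩
      K * Lq                                            ≡⟨ cong (K *_) (sym (/-*-⟦⟧ (+ l) n)) ⟩
      K * ((+ l / n) * N)                               ≡⟨ sym (staircase-gap N j K (+ l / n)) ⟩
      N * ((j + K) * (+ l / n) - j * (+ l / n))         ≡⟨ cong (N *_) (sym (cong₂ _-_ a′≡j a≡j)) ⟩
      N * (a′ - a)                                      ≡⟨ cong (N *_) (cong₂ _-_ a′≡ a≡) ⟩
      N * ((X′ - cq * Y′) - (X - cq * Y))               ≡⟨ scale-difference N cq X Y X′ Y′ ⟩
      (N * X′ - (cq * N) * Y′) - (N * X - (cq * N) * Y) ≡⟨ cong (λ u → (N * X′ - u * Y′) - (N * X - u * Y)) c*N≡M ⟩
      (N * X′ - M * Y′) - (N * X - M * Y)               ≡⟨ sym (cong₂ _-_ (⟦A⟧ x′ y′) (⟦A⟧ x y)) ⟩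
      ⟦ A x′ y′ ⟧ - ⟦ A x y ⟧                           ≡⟨ sym (⟦⟧-homo-− (A x′ y′) (A x y)) ⟩
      ⟦ A x′ y′ ℤ.- A x y ⟧                             ≡⟨ cong ⟦_⟧ (scaled-difference L (s x′ y′) (s x y)) ⟩
      ⟦ L ℤ.* (s x′ y′ ℤ.- s x y) ⟧                     ≡⟨ ⟦⟧-homo-* L (s x′ y′ ℤ.- s x y) ⟩
      Lq * ⟦ s x′ y′ ℤ.- s x y ⟧                        ∎)
    where
    open ≡-Reasoning
    cq = c (suc m′) n
    X = ⟦ x ⟧
    Y = ⟦ y ⟧
    X′ = ⟦ x′ ⟧
    Y′ = ⟦ y′ ⟧

  Phat≡P : ∀ {a b x y} → a ≡ ⟦ x ⟧ - c (suc m′) n * ⟦ y ⟧ → b ≡ ⟦ y ⟧ →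
           Phat (suc m′) n D E F a b ≡ P (suc m′) n D E F ⟦ x ⟧ ⟦ y ⟧
  Phat≡P {x = x} {y} refl refl =
    cong (λ u → P (suc m′) n D E F u ⟦ y ⟧) (undo-shear ⟦ x ⟧ (c (suc m′) n) ⟦ y ⟧)

  ⟦quadratic⟧ : ∀ a b κ y c →
    ⟦ a ℤ.* a ℤ.+ b ℤ.* a ℤ.+ 2ℤ ℤ.* κ ℤ.* y ℤ.+ c ⟧ ≡ ⟦ a ⟧ * ⟦ a ⟧ + ⟦ b ⟧ * ⟦ a ⟧ + two * ⟦ κ ⟧ * ⟦ y ⟧ + ⟦ c ⟧
  ⟦quadratic⟧ a b κ y c = begin
    ⟦ a ℤ.* a ℤ.+ b ℤ.* a ℤ.+ 2ℤ ℤ.* κ ℤ.* y ℤ.+ c ⟧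
      ≡⟨ ⟦⟧-homo-+ (a ℤ.* a ℤ.+ b ℤ.* a ℤ.+ 2ℤ ℤ.* κ ℤ.* y) c ⟩
    ⟦ a ℤ.* a ℤ.+ b ℤ.* a ℤ.+ 2ℤ ℤ.* κ ℤ.* y ⟧ + ⟦ c ⟧
      ≡⟨ cong (_+ ⟦ c ⟧) (⟦⟧-homo-+ (a ℤ.* a ℤ.+ b ℤ.* a) (2ℤ ℤ.* κ ℤ.* y)) ⟩
    ⟦ a ℤ.* a ℤ.+ b ℤ.* a ⟧ + ⟦ 2ℤ ℤ.* κ ℤ.* y ⟧ + ⟦ c ⟧
      ≡⟨ cong₂ (λ u v → u + v + ⟦ c ⟧)
               (trans (⟦⟧-homo-+ (a ℤ.* a) (b ℤ.* a)) (cong₂ _+_ (⟦⟧-homo-* a a) (⟦⟧-homo-* b a)))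
               (trans (⟦⟧-homo-* (2ℤ ℤ.* κ) y) (cong (_* ⟦ y ⟧) (⟦⟧-homo-* 2ℤ κ))) ⟩
    ⟦ a ⟧ * ⟦ a ⟧ + ⟦ b ⟧ * ⟦ a ⟧ + two * ⟦ κ ⟧ * ⟦ y ⟧ + ⟦ c ⟧  ∎
    where open ≡-Reasoning

  σ β C : ℤ
  σ = 2ℤ ℤ.* + n
  β = 2ℤ ℤ.* D ℤ.- + n
  C = σ ℤ.* F

  instance
    σ≢0 : ℤ.NonZero σ
    σ≢0 = ℤ.i*j≢0 2ℤ (+ n)

  module IntegerPacking (k : ℕ) (⟦k⟧≡K : ⟦ + k ⟧ ≡ K)
                        (qpp : IsQPPonI (suc m′) n (P (suc m′) n D E F)) where

    open Packing l n₁ m₁ coprime k β C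

    ⟦H⟧ : ∀ x y → ⟦ H x y ⟧ ≡ ⟦ σ ⟧ * P (suc m′) n D E F ⟦ x ⟧ ⟦ y ⟧
    ⟦H⟧ x y = begin
      ⟦ H x y ⟧
        ≡⟨ ⟦quadratic⟧ (A x y) β κ y C ⟩
      quadratic ⟦ A x y ⟧ ⟦ β ⟧ ⟦ κ ⟧ ⟦ C ⟧
        ≡⟨ cong₂ (λ u v → quadratic u v ⟦ κ ⟧ ⟦ C ⟧) (⟦A⟧ x y)
                 (trans (⟦⟧-homo-− (2ℤ ℤ.* D) (+ n)) (cong (_- N) (⟦⟧-homo-* 2ℤ D))) ⟩
      quadratic (N * X - M * Y) (two * ⟦ D ⟧ - N) ⟦ κ ⟧ ⟦ C ⟧
        ≡⟨ cong₂ (quadratic (N * X - M * Y) (two * ⟦ D ⟧ - N))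
                 (trans (⟦⟧-homo-* L (+ k)) (cong (Lq *_) ⟦k⟧≡K))
                 (trans (⟦⟧-homo-* σ F) (cong (_* ⟦ F ⟧) (⟦⟧-homo-* 2ℤ (+ n)))) ⟩
      quadratic (N * X - M * Y) (two * ⟦ D ⟧ - N) (Lq * K) (two * N * ⟦ F ⟧)
        ≡⟨ sym (twice-n-P X Y) ⟩
      two * N * P (suc m′) n D E F X Y
        ≡⟨ cong (_* P (suc m′) n D E F X Y) (sym (⟦⟧-homo-* 2ℤ (+ n))) ⟩
      ⟦ σ ⟧ * P (suc m′) n D E F X Y  ∎
      where
      open ≡-Reasoning
      X = ⟦ x ⟧
      Y = ⟦ y ⟧
      quadratic : ℚ → ℚ → ℚ → ℚ → ℚ
      quadratic a b q c′ = a * a + b * a + two * q * Y + c′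

    H-value : ∀ {x y v} → P (suc m′) n D E F ⟦ x ⟧ ⟦ y ⟧ ≡ ⟦ + v ⟧ → H x y ≡ σ ℤ.* + v
    H-value {x} {y} {v} eq =
      ⟦⟧-injective (trans (⟦H⟧ x y) (trans (cong (⟦ σ ⟧ *_) eq) (sym (⟦⟧-homo-* σ (+ v)))))

    ρ≡σ*k : ρ ≡ σ ℤ.* + k
    ρ≡σ*k = trans (scaled-period L N₁ (+ k)) (cong (λ ν → 2ℤ ℤ.* ν ℤ.* + k) (sym +n≡L*N₁))

    H-injective : ∀ {x y x′ y′} → In x y → In x′ y′ → H x y ≡ H x′ y′ → x ≡ x′ × y ≡ y′
    H-injective {x} {y} {x′} {y′} p p′ eq = proj₁ (proj₂ qpp) x y x′ y′ (In⇒InI p) (In⇒InI p′)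
      (⟦⟧-*-cancelˡ σ _ _ (trans (sym (⟦H⟧ x y)) (trans (cong ⟦_⟧ eq) (⟦H⟧ x′ y′))))

    H-next : ∀ {x y} → In x y → ∃[ x′ ] ∃[ y′ ] In x′ y′ × H x′ y′ ≡ H x y ℤ.+ ρ
    H-next {x} {y} p = x′ , y′ , InI⇒In p′ , (begin
      H x′ y′                        ≡⟨ H-value Pv′ ⟩
      σ ℤ.* + (v ℕ.+ k)              ≡⟨ cong (σ ℤ.*_) (ℤ.pos-+ v k) ⟩
      σ ℤ.* (+ v ℤ.+ + k)            ≡⟨ ℤ.*-distribˡ-+ σ (+ v) (+ k) ⟩
      σ ℤ.* + v ℤ.+ σ ℤ.* + k        ≡⟨ sym (cong₂ ℤ._+_ (H-value Pv) ρ≡σ*k) ⟩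
      H x y ℤ.+ ρ                    ∎)
      where
      open ≡-Reasoning
      value = proj₁ qpp x y (In⇒InI p)
      v = proj₁ value
      Pv = proj₂ value
      hit = proj₂ (proj₂ qpp) (v ℕ.+ k)
      x′ = proj₁ hit
      y′ = proj₁ (proj₂ hit)
      p′ = proj₁ (proj₂ (proj₂ hit))
      Pv′ = proj₂ (proj₂ (proj₂ hit))

    value-difference : ∀ {x y x′ y′} → InI (suc m′) n x y → InI (suc m′) n x′ y′ →
                       s x′ y′ ≡ s x y ℤ.+ + k →
                       ∃[ t ] P (suc m′) n D E F ⟦ x ⟧ ⟦ y ⟧ - P (suc m′) n D E F ⟦ x′ ⟧ ⟦ y′ ⟧ ≡ ⟦ t ⟧ * K
    value-difference {x} {y} {x′} {y′} p p′ eq = ℤ.- t , ⟦⟧-*-cancelˡ σ _ _ (begin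
      ⟦ σ ⟧ * (P′ x y - P′ x′ y′)            ≡⟨ *-distribˡ-− ⟦ σ ⟧ (P′ x y) (P′ x′ y′) ⟩
      ⟦ σ ⟧ * P′ x y - ⟦ σ ⟧ * P′ x′ y′      ≡⟨ sym (cong₂ _-_ (⟦H⟧ x y) (⟦H⟧ x′ y′)) ⟩
      ⟦ H x y ⟧ - ⟦ H x′ y′ ⟧                ≡⟨ sym (⟦⟧-homo-− (H x y) (H x′ y′)) ⟩
      ⟦ H x y ℤ.- H x′ y′ ⟧                  ≡⟨ cong ⟦_⟧ H-H′≡ ⟩
      ⟦ σ ℤ.* (ℤ.- t ℤ.* + k) ⟧              ≡⟨ ⟦⟧-homo-* σ (ℤ.- t ℤ.* + k) ⟩
      ⟦ σ ⟧ * ⟦ ℤ.- t ℤ.* + k ⟧              ≡⟨ cong (⟦ σ ⟧ *_) (trans (⟦⟧-homo-* (ℤ.- t) (+ k)) (cong (⟦ ℤ.- t ⟧ *_) ⟦k⟧≡K)) ⟩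
      ⟦ σ ⟧ * (⟦ ℤ.- t ⟧ * K)                ∎)
      where
      open ≡-Reasoning
      ρ∣H′-H = congruence H-injective H-next (InI⇒In p) (InI⇒In p′) eq
      t = _∣_.quotient ρ∣H′-H
      H′-H≡ = _∣_.equality ρ∣H′-H
      P′ : ℤ → ℤ → ℚ
      P′ u v = P (suc m′) n D E F ⟦ u ⟧ ⟦ v ⟧
      H-H′≡ : H x y ℤ.- H x′ y′ ≡ σ ℤ.* (ℤ.- t ℤ.* + k)
      H-H′≡ = trans (negate-difference (H x y) (H x′ y′))
                (trans (cong ℤ.-_ (trans H′-H≡ (cong (t ℤ.*_) ρ≡σ*k))) (negate-multiple t σ (+ k)))

lemma4 : (m n : ℕ) ⦃ _ : NonZero m ⦄ ⦃ _ : NonZero n ⦄ → Coprime m n →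
         (D E F : ℤ) → IsQPPonI m n (P m n D E F) → 0ℚ < k m n D E F →
         (i : ℕ) (a b a′ b′ : ℚ) →
         InJhat m n ⟦ + i ⟧ a b →
         InJhat m n (⟦ + i ⟧ + k m n D E F) a′ b′ →
         CongMod (k m n D E F) (Phat m n D E F a b) (Phat m n D E F a′ b′)
lemma4 (suc m′) n _ D E F qpp 0<K i a b a′ b′
       ((x , y , p , a≡ , b≡) , a≡i) ((x′ , y′ , p′ , a′≡ , b′≡) , a′≡i) =
  proj₁ difference ,
  trans (cong₂ _-_ (Phat≡P {x = x} {y} a≡ b≡) (Phat≡P {x = x′} {y′} a′≡ b′≡)) (proj₂ difference)
  where
  open Bridge m′ n D E F
  K≡ : K ≡ ⟦ s x′ y′ ℤ.- s x y ⟧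
  K≡ = K≡index-difference {⟦ + i ⟧} {x = x} {y} {x′} {y′} a≡ a′≡ a≡i a′≡i
  0≤Δ : ℤ.0ℤ ℤ.≤ s x′ y′ ℤ.- s x y
  0≤Δ = ℤ.<⇒≤ (⟦⟧-cancel-< (subst (0ℚ <_) K≡ 0<K))
  +∣Δ∣≡Δ : + ℤ.∣ s x′ y′ ℤ.- s x y ∣ ≡ s x′ y′ ℤ.- s x y
  +∣Δ∣≡Δ = ℤ.0≤i⇒+∣i∣≡i 0≤Δ
  open IntegerPacking ℤ.∣ s x′ y′ ℤ.- s x y ∣ (trans (cong ⟦_⟧ +∣Δ∣≡Δ) (sym K≡)) qpp
  difference = value-difference p p′
    (trans (i≡j+[i-j] (s x′ y′) (s x y)) (cong (ℤ._+_ (s x y)) (sym +∣Δ∣≡Δ)))
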